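{- Run algorithm Tight-VC-HC on an instance of VC-HC admitting a feasible assignment, with maximum edge size $f\ge2$, and let $k$ be the number of iterations of Step 2. For $1\le i\le k$ let $\Psi^{(i)}=(\mathcal E^{(i)},\boldsymbol\ell^{(i)},\mathbf c^{(i)})$ be the values of $(\mathcal E,\boldsymbol\ell,\mathbf c')$ at the start of iteration $i$, and $(\mathbf x^{(i)},\mathbf h^{(i)})$ the basic optimal solution of $\mathrm{LP}(\Psi^{(i)})$ computed in iteration $i$. Then for every $1\le i<k$, the point $(\mathbf x^{(i)},\mathbf h^{(i)}|_{\mathcal E^{(i+1)}})$ is feasible for $\mathrm{LP}(\Psi^{(i+1)})$, where $(\mathbf h^{(i)}|_{\mathcal E^{(i+1)}})_{e,v}:=h^{(i)}_{e,v}$ for $e\in\mathcal E^{(i+1)}$, $v\in e$.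
   Context: VC-HC: a hypergraph $G=(V,E)$ with $E\subseteq 2^V$, $f:=\max_{e\in E}|e|$; demands $d_e\ge0$, capacities $c_v\ge0$, integer multiplicities $m_v\ge0$. An assignment $h$ with $h_{e,v}\ge0$ ($e\in E,v\in e$) is feasible if $\sum_{v\in e}h_{e,v}=1$ for all $e$ and $\lceil\sum_{e\ni v}d_eh_{e,v}/c_v\rceil\le m_v$ for all $v$. For $E'\subseteq E$, $\mathbf0\le\boldsymbol\ell\le\mathbf m$ and capacities $\mathbf c'$, $\mathrm{LP}(E',\boldsymbol\ell,\mathbf c')$ minimizes $\sum_{v\in V}x_v$ subject to: $\sum_{v\in e}h_{e,v}=1$ ($e\in E'$); $\sum_{e\in E',\,v\in e}d_eh_{e,v}\le c'_vx_v$ ($v\in V$); $\ell_v\le x_v\le m_v$ ($v\in V$); $0\le h_{e,v}\le x_v$ ($e\in E'$, $v\in e$). A basic optimal solution is an optimal extreme point of the feasible region. Algorithm Tight-VC-HC. Step 1: set $\mathcal E:=E$, $h'_{e,v}:=0$, $\ell_v:=0$, $c'_v:=c_v$. Step 2: repeat: (a) solve $\mathrm{LP}(\mathcal E,\boldsymbol\ell,\mathbf c')$ for a basic optimal solution $(\mathbf x,\mathbf h)$; (b) $I:=\{v:0<x_v<1/f\}$; (c) for $e\in\mathcal E$, $T(e):=\{v\in e\setminus I:0<h_{e,v}=x_v\}$; (d) if all $T(e)$ are empty go to Step 3; (e) for each $e\in\mathcal E$ with $T(e)\ne\emptyset$: pick an arbitrary $v\in T(e)$ and set $h'_{e,v}:=1$;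 for all $v\in T(e)$ decrease $c'_v$ by $d_e$ and set $\ell_v:=x_v$; remove $e$ from $\mathcal E$. Step 3: output $x^*_v:=\lceil x_v\rceil$ and $h^*_{e,v}:=h_{e,v}$ if $e\in\mathcal E$, $h^*_{e,v}:=h'_{e,v}$ otherwise (using the last iteration's values).
   Formalization: The demands $d_e$, the capacities $c_v$, the feasible assignment and the points of every LP, including the basic optimal solutions, take rational values. -}

module Defs where

open import Data.Nat as ℕ using (ℕ; zero; suc)
open import Data.Fin using (Fin)
import Data.Fin as Fin
open import Data.Bool using (Bool; true; false; _∧_; _∨_; not; if_then_else_)
open import Data.Integer as ℤ using (ℤ; +_)
open import Data.Rational as ℚ using (ℚ; 0ℚ; 1ℚ; _+_; _*_; _-_; _≤_; _<_; _÷_; ceiling)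
open import Data.Rational.Properties using (_≟_; _≤?_; _<?_)
open import Data.Product using (Σ; ∃; _×_)
open import Relation.Nullary using (yes; no)
open import Relation.Nullary.Decidable using (⌊_⌋)
open import Relation.Binary.PropositionalEquality using (_≡_)

sumFin : (k : ℕ) → (Fin k → ℚ) → ℚ
sumFin zero    g = 0ℚ
sumFin (suc k) g = g Fin.zero + sumFin k (λ i → g (Fin.suc i))

countFin : (k : ℕ) → (Fin k → Bool) → ℕ
countFin zero    g = 0
countFin (suc k) g = (if g Fin.zero then 1 else 0) ℕ.+ countFin k (λ i → g (Fin.suc i))

maxFin : (k : ℕ) → (Fin k → ℕ) → ℕ
maxFin zero    g = 0
maxFin (suc k) g = g Fin.zero ℕ.⊔ maxFin k (λ i → g (Fin.suc i))

anyFin : (k : ℕ) → (Fin k → Bool) → Bool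
anyFin zero    g = false
anyFin (suc k) g = g Fin.zero ∨ anyFin k (λ i → g (Fin.suc i))

ℕ→ℚ : ℕ → ℚ
ℕ→ℚ k = (+ k) ℚ./ 1

-- 1/f  (f ≥ 2 in the theorem, so the zero case is never used)
inv : ℕ → ℚ
inv zero    = 0ℚ
inv (suc k) = (+ 1) ℚ./ (suc k)

_<ᵇ_ : ℚ → ℚ → Bool
p <ᵇ q = ⌊ p <? q ⌋

_==ᵇ_ : ℚ → ℚ → Bool
p ==ᵇ q = ⌊ p ≟ q ⌋

-- VC-HC instances.  V = Fin n, E indexed by Fin m, e ∋ v iff mem e v ≡ true.

record Instance : Set where
  field
    n    : ℕ
    m    : ℕ
    mem  : Fin m → Fin n → Bool
    dem  : Fin m → ℚ
    cap  : Fin n → ℚ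
    mult : Fin n → ℕ
open Instance public

fmax : Instance → ℕ
fmax I = maxFin (m I) (λ e → countFin (n I) (mem I e))

-- E ⊆ 2^V is a set: distinct indices are distinct edges; data nonnegative
WellFormed : Instance → Set
WellFormed I =
  (∀ e e' → (∀ v → mem I e v ≡ mem I e' v) → e ≡ e')
  × (∀ e → 0ℚ ≤ dem I e)
  × (∀ v → 0ℚ ≤ cap I v)

-- ⌈ load / c ⌉ ≤ mv ; for c = 0 we read load/0 as admissible only when load = 0
CapOK : ℚ → ℚ → ℕ → Set
CapOK load c mv with c ≟ 0ℚ
... | yes _  = load ≡ 0ℚ
... | no c≢0 = ceiling ((load ÷ c) {{ℚ.≢-nonZero c≢0}}) ℤ.≤ + mv

load : (I : Instance) → (Fin (m I) → Bool) → (Fin (m I) → Fin (n I) → ℚ) → Fin (n I) → ℚ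
load I E' h v = sumFin (m I) (λ e → if E' e ∧ mem I e v then dem I e * h e v else 0ℚ)

edgeSum : (I : Instance) → (Fin (m I) → Fin (n I) → ℚ) → Fin (m I) → ℚ
edgeSum I h e = sumFin (n I) (λ v → if mem I e v then h e v else 0ℚ)

FeasibleAssignment : (I : Instance) → (Fin (m I) → Fin (n I) → ℚ) → Set
FeasibleAssignment I h =
  (∀ e v → mem I e v ≡ true → 0ℚ ≤ h e v)
  × (∀ e → edgeSum I h e ≡ 1ℚ)
  × (∀ v → CapOK (load I (λ _ → true) h v) (cap I v) (mult I v))

record LPState (I : Instance) : Set where
  constructor ⟨_,_,_⟩
  field
    edges : Fin (m I) → Bool
    low   : Fin (n I) → ℚ
    capL  : Fin (n I) → ℚ
open LPState public

record Point (I : Instance) : Set where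
  constructor pt
  field
    xs : Fin (n I) → ℚ
    hs : Fin (m I) → Fin (n I) → ℚ
open Point public

LPFeasible : (I : Instance) → LPState I → Point I → Set
LPFeasible I Ψ p =
  (∀ e → edges Ψ e ≡ true → edgeSum I (hs p) e ≡ 1ℚ)
  × (∀ v → load I (edges Ψ) (hs p) v ≤ capL Ψ v * xs p v)
  × (∀ v → low Ψ v ≤ xs p v)
  × (∀ v → xs p v ≤ ℕ→ℚ (mult I v))
  × (∀ e v → edges Ψ e ≡ true → mem I e v ≡ true → 0ℚ ≤ hs p e v × hs p e v ≤ xs p v)

objective : (I : Instance) → Point I → ℚ
objective I p = sumFin (n I) (xs p)

SamePoint : (I : Instance) → LPState I → Point I → Point I → Set
SamePoint I Ψ p q =
  (∀ v → xs p v ≡ xs q v)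
  × (∀ e v → edges Ψ e ≡ true → mem I e v ≡ true → hs p e v ≡ hs q e v)

IsCombination : (I : Instance) → LPState I → ℚ → Point I → Point I → Point I → Set
IsCombination I Ψ λ' r p q =
  (∀ v → xs r v ≡ λ' * xs p v + (1ℚ - λ') * xs q v)
  × (∀ e v → edges Ψ e ≡ true → mem I e v ≡ true →
       hs r e v ≡ λ' * hs p e v + (1ℚ - λ') * hs q e v)

ExtremePoint : (I : Instance) → LPState I → Point I → Set
ExtremePoint I Ψ r =
  LPFeasible I Ψ r
  × (∀ p q λ' → LPFeasible I Ψ p → LPFeasible I Ψ q → 0ℚ < λ' → λ' < 1ℚ →
       IsCombination I Ψ λ' r p q → SamePoint I Ψ p q)

Optimal : (I : Instance) → LPState I → Point I → Set
Optimal I Ψ r =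
  LPFeasible I Ψ r × (∀ q → LPFeasible I Ψ q → objective I r ≤ objective I q)

BasicOptimal : (I : Instance) → LPState I → Point I → Set
BasicOptimal I Ψ r = Optimal I Ψ r × ExtremePoint I Ψ r

inIset : (I : Instance) → Point I → Fin (n I) → Bool
inIset I p v = (0ℚ <ᵇ xs p v) ∧ (xs p v <ᵇ inv (fmax I))

inT : (I : Instance) → LPState I → Point I → Fin (m I) → Fin (n I) → Bool
inT I Ψ p e v =
  edges Ψ e ∧ mem I e v ∧ not (inIset I p v)
  ∧ (0ℚ <ᵇ hs p e v) ∧ (hs p e v ==ᵇ xs p v)

Tnonempty : (I : Instance) → LPState I → Point I → Fin (m I) → Bool
Tnonempty I Ψ p e = anyFin (n I) (inT I Ψ p e)

InitialState : (I : Instance) → LPState I → Set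
InitialState I Ψ =
  (∀ e → edges Ψ e ≡ true) × (∀ v → low Ψ v ≡ 0ℚ) × (∀ v → capL Ψ v ≡ cap I v)

Update : (I : Instance) → LPState I → Point I → LPState I → Set
Update I Ψ p Ψ' =
  (∀ e → edges Ψ' e ≡ (edges Ψ e ∧ not (Tnonempty I Ψ p e)))
  × (∀ v → capL Ψ' v ≡ capL Ψ v - sumFin (m I) (λ e → if inT I Ψ p e v then dem I e else 0ℚ))
  × (∀ v → low Ψ' v ≡ (if anyFin (m I) (λ e → inT I Ψ p e v) then xs p v else low Ψ v))

-- A run with exactly k iterations of Step 2: states Ψ i and LP solutions sol i, 1 ≤ i ≤ k
record Run (I : Instance) (k : ℕ) : Set where
  field
    Ψ       : ℕ → LPState I
    sol     : ℕ → Point I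
    k≥1     : 1 ℕ.≤ k
    init    : InitialState I (Ψ 1)
    basic   : ∀ i → 1 ℕ.≤ i → i ℕ.≤ k → BasicOptimal I (Ψ i) (sol i)
    continue : ∀ i → 1 ℕ.≤ i → i ℕ.< k → ∃ λ e → Tnonempty I (Ψ i) (sol i) e ≡ true
    update  : ∀ i → 1 ℕ.≤ i → i ℕ.< k → Update I (Ψ i) (sol i) (Ψ (suc i))
    stop    : ∀ e → Tnonempty I (Ψ k) (sol k) e ≡ false
open Run public

-- Step 2(e) only deletes edges and raises ℓ_v to x_v, so every constraint of the
-- next LP that involves a surviving edge is one the current point already met.
-- The only new content is the capacity at v: c'_v drops by the total demand of
-- the deleted edges e with v ∈ T(e), but each such edge carried load
-- d_e h_{e,v} = d_e x_v at v, so the load at v drops by at least as much as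
-- c'_v x_v does.
module Submission where

open import Defs
open import Data.Nat using (ℕ; _≤_; _<_; suc)
open import Data.Nat.Properties using (<⇒≤)
open import Data.Fin using (Fin; zero; suc)
open import Data.Bool using (Bool; true; false; _∧_; not; if_then_else_)
open import Data.Bool.Properties using (∧-zeroʳ; ∨-zeroʳ; T-≡)
open import Data.Rational as ℚ using (ℚ; 0ℚ; _+_; _*_; _-_; -_)
import Data.Rational.Properties as ℚₚ
open import Data.Product using (∃; _×_; _,_; proj₁; uncurry)
open import Function.Bundles using (Equivalence)
open import Relation.Nullary.Decidable using (toWitness)
open import Relation.Binary.PropositionalEquality
open import Algebra.Bundles using (CommutativeMonoid)
open import Algebra.Properties.CommutativeSemigroup
  (CommutativeMonoid.commutativeSemigroup ℚₚ.+-0-commutativeMonoid) using (interchange)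
open import Algebra.Properties.Group ℚₚ.+-0-group using (//-rightDividesʳ)

sumFin-mono-≤ : ∀ k (f g : Fin k → ℚ) → (∀ i → f i ℚ.≤ g i) → sumFin k f ℚ.≤ sumFin k g
sumFin-mono-≤ ℕ.zero  f g f≤g = ℚₚ.≤-refl
sumFin-mono-≤ (suc k) f g f≤g =
  ℚₚ.+-mono-≤ (f≤g zero) (sumFin-mono-≤ k (λ i → f (suc i)) (λ i → g (suc i)) (λ i → f≤g (suc i)))

sumFin-+ : ∀ k (f g : Fin k → ℚ) → sumFin k (λ i → f i + g i) ≡ sumFin k f + sumFin k g
sumFin-+ ℕ.zero  f g = sym (ℚₚ.+-identityˡ 0ℚ)
sumFin-+ (suc k) f g = begin
  (f zero + g zero) + sumFin k (λ i → f (suc i) + g (suc i))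
    ≡⟨ cong ((f zero + g zero) +_) (sumFin-+ k (λ i → f (suc i)) (λ i → g (suc i))) ⟩
  (f zero + g zero) + (sumFin k (λ i → f (suc i)) + sumFin k (λ i → g (suc i)))
    ≡⟨ interchange (f zero) (g zero) _ _ ⟩
  (f zero + sumFin k (λ i → f (suc i))) + (g zero + sumFin k (λ i → g (suc i))) ∎
  where open ≡-Reasoning

sumFin-*ʳ : ∀ k (f : Fin k → ℚ) x → sumFin k (λ i → f i * x) ≡ sumFin k f * x
sumFin-*ʳ ℕ.zero  f x = sym (ℚₚ.*-zeroˡ x)
sumFin-*ʳ (suc k) f x = begin
  f zero * x + sumFin k (λ i → f (suc i) * x)  ≡⟨ cong (f zero * x +_) (sumFin-*ʳ k (λ i → f (suc i)) x) ⟩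
  f zero * x + sumFin k (λ i → f (suc i)) * x  ≡⟨ ℚₚ.*-distribʳ-+ x (f zero) _ ⟨
  (f zero + sumFin k (λ i → f (suc i))) * x    ∎
  where open ≡-Reasoning

anyFin-true : ∀ k (g : Fin k → Bool) i → g i ≡ true → anyFin k g ≡ true
anyFin-true (suc k) g zero    gi rewrite gi = refl
anyFin-true (suc k) g (suc i) gi
  rewrite anyFin-true k (λ j → g (suc j)) i gi = ∨-zeroʳ (g zero)

∧-true : ∀ {a b} → a ∧ b ≡ true → a ≡ true × b ≡ true
∧-true {true} b = refl , b

==ᵇ-sound : ∀ {p q} → (p ==ᵇ q) ≡ true → p ≡ q
==ᵇ-sound {p} {q} eq = toWitness {a? = p ℚₚ.≟ q} (Equivalence.from T-≡ eq)

if-true-mono-≤ : ∀ {b b′ q} → (b ≡ true → b′ ≡ true) → (b′ ≡ true → 0ℚ ℚ.≤ q) →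
  (if b then q else 0ℚ) ℚ.≤ (if b′ then q else 0ℚ)
if-true-mono-≤ {false} {false} _    _  = ℚₚ.≤-refl
if-true-mono-≤ {false} {true}  _    0≤q = 0≤q refl
if-true-mono-≤ {true}  {true}  _    _  = ℚₚ.≤-refl
if-true-mono-≤ {true}  {false} b⇒b′ _  with b⇒b′ refl
... | ()

p+q*x≤r*x⇒p≤[r-q]*x : ∀ p q r x → p + q * x ℚ.≤ r * x → p ℚ.≤ (r - q) * x
p+q*x≤r*x⇒p≤[r-q]*x p q r x le =
  subst₂ ℚ._≤_ (//-rightDividesʳ (q * x) p) [r-q]*x (ℚₚ.+-monoˡ-≤ (- (q * x)) le)
  where
  [r-q]*x : r * x - q * x ≡ (r - q) * x
  [r-q]*x = trans (cong (r * x +_) (ℚₚ.neg-distribˡ-* q x)) (sym (ℚₚ.*-distribʳ-+ x r (- q)))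

*-nonNeg : ∀ {p q} → 0ℚ ℚ.≤ p → 0ℚ ℚ.≤ q → 0ℚ ℚ.≤ p * q
*-nonNeg {p} {q} 0≤p 0≤q = ℚₚ.nonNegative⁻¹ (p * q)
  {{ℚₚ.nonNeg*nonNeg⇒nonNeg p {{ℚ.nonNegative 0≤p}} q {{ℚ.nonNegative 0≤q}}}}

removedDemand : (I : Instance) → LPState I → Point I → Fin (n I) → ℚ
removedDemand I Ψ p v = sumFin (m I) (λ e → if inT I Ψ p e v then dem I e else 0ℚ)

inT-sound : ∀ I Ψ p e v → inT I Ψ p e v ≡ true →
  edges Ψ e ≡ true × mem I e v ≡ true × hs p e v ≡ xs p v
inT-sound I Ψ p e v t =
  let (e∈𝓔 , t₁) = ∧-true {edges Ψ e} t
      (v∈e , t₂) = ∧-true {mem I e v} t₁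
      (_   , t₃) = ∧-true {not (inIset I p v)} t₂
      (_   , h≡x) = ∧-true {0ℚ <ᵇ hs p e v} t₃
  in e∈𝓔 , v∈e , ==ᵇ-sound h≡x

module _ (I : Instance) {Ψ Ψ′ : LPState I} {p : Point I} (upd : Update I Ψ p Ψ′) where

  private
    edges-update : ∀ e → edges Ψ′ e ≡ (edges Ψ e ∧ not (Tnonempty I Ψ p e))
    edges-update = proj₁ upd

    capL-update : ∀ v → capL Ψ′ v ≡ capL Ψ v - removedDemand I Ψ p v
    capL-update v = let (_ , capL-upd , _) = upd in capL-upd v

    low-update : ∀ v → low Ψ′ v ≡ (if anyFin (m I) (λ e → inT I Ψ p e v) then xs p v else low Ψ v)
    low-update v = let (_ , _ , low-upd) = upd in low-upd v

  edges-shrink : ∀ e → edges Ψ′ e ≡ true → edges Ψ e ≡ true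
  edges-shrink e e∈𝓔′ = proj₁ (∧-true (trans (sym (edges-update e)) e∈𝓔′))

  inT-removed : ∀ e v → inT I Ψ p e v ≡ true → edges Ψ′ e ≡ false
  inT-removed e v t rewrite edges-update e | anyFin-true (n I) (inT I Ψ p e) v t =
    ∧-zeroʳ (edges Ψ e)

  load-drop : (∀ e → 0ℚ ℚ.≤ dem I e) →
    (∀ e v → edges Ψ e ≡ true → mem I e v ≡ true → 0ℚ ℚ.≤ hs p e v) →
    ∀ v → load I (edges Ψ′) (hs p) v + removedDemand I Ψ p v * xs p v
            ℚ.≤ load I (edges Ψ) (hs p) v
  load-drop 0≤d 0≤h v = begin
    sumFin (m I) new + sumFin (m I) removed * x
      ≡⟨ cong (sumFin (m I) new +_) (sumFin-*ʳ (m I) removed x) ⟨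
    sumFin (m I) new + sumFin (m I) (λ e → removed e * x)
      ≡⟨ sumFin-+ (m I) new (λ e → removed e * x) ⟨
    sumFin (m I) (λ e → new e + removed e * x)
      ≤⟨ sumFin-mono-≤ (m I) _ old per-edge ⟩
    sumFin (m I) old ∎
    where
    open ℚₚ.≤-Reasoning
    x = xs p v
    new old removed : Fin (m I) → ℚ
    new e = if edges Ψ′ e ∧ mem I e v then dem I e * hs p e v else 0ℚ
    old e = if edges Ψ e ∧ mem I e v then dem I e * hs p e v else 0ℚ
    removed e = if inT I Ψ p e v then dem I e else 0ℚ

    per-edge : ∀ e → new e + removed e * x ℚ.≤ old e
    per-edge e with inT I Ψ p e v in t
    ... | true
      with (e∈𝓔 , v∈e , h≡x) ← inT-sound I Ψ p e v t
      rewrite inT-removed e v t | e∈𝓔 | v∈e | h≡x = ℚₚ.≤-reflexive (ℚₚ.+-identityˡ _)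
    ... | false = subst (ℚ._≤ old e) (sym new+0*x≡new)
      (if-true-mono-≤ shrink (λ e∧v → *-nonNeg (0≤d e) (uncurry (0≤h e v) (∧-true e∧v))))
      where
      new+0*x≡new : new e + 0ℚ * x ≡ new e
      new+0*x≡new = trans (cong (new e +_) (ℚₚ.*-zeroˡ x)) (ℚₚ.+-identityʳ (new e))
      shrink : edges Ψ′ e ∧ mem I e v ≡ true → edges Ψ e ∧ mem I e v ≡ true
      shrink e∧v with (e∈𝓔′ , v∈e) ← ∧-true e∧v rewrite edges-shrink e e∈𝓔′ = v∈e

  LPFeasible-update : (∀ e → 0ℚ ℚ.≤ dem I e) → LPFeasible I Ψ p → LPFeasible I Ψ′ p
  LPFeasible-update 0≤d (sums , load≤ , ℓ≤x , x≤m , h-bounds) =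
      (λ e e∈𝓔′ → sums e (edges-shrink e e∈𝓔′))
    , capacity
    , lower
    , x≤m
    , (λ e v e∈𝓔′ → h-bounds e v (edges-shrink e e∈𝓔′))
    where
    capacity : ∀ v → load I (edges Ψ′) (hs p) v ℚ.≤ capL Ψ′ v * xs p v
    capacity v rewrite capL-update v =
      p+q*x≤r*x⇒p≤[r-q]*x _ (removedDemand I Ψ p v) (capL Ψ v) (xs p v)
        (ℚₚ.≤-trans (load-drop 0≤d 0≤h v) (load≤ v))
      where
      0≤h : ∀ e v → edges Ψ e ≡ true → mem I e v ≡ true → 0ℚ ℚ.≤ hs p e v
      0≤h e v e∈𝓔 v∈e = proj₁ (h-bounds e v e∈𝓔 v∈e)

    lower : ∀ v → low Ψ′ v ℚ.≤ xs p v
    lower v rewrite low-update v with anyFin (m I) (λ e → inT I Ψ p e v)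
    ... | true  = ℚₚ.≤-refl
    ... | false = ℓ≤x v

-- Only the feasibility of (x⁽ⁱ⁾, h⁽ⁱ⁾) and d ≥ 0 are used: neither optimality,
-- extremality, the feasible assignment nor f ≥ 2 plays a role here.
lemma2 : (I : Instance) → WellFormed I →
    (∃ λ h → FeasibleAssignment I h) → 2 ≤ fmax I →
    (k : ℕ) → (R : Run I k) →
    ∀ i → 1 ≤ i → i < k → LPFeasible I (Ψ R (suc i)) (sol R i)
lemma2 I (_ , 0≤d , _) _ _ k R i 1≤i i<k =
  LPFeasible-update I {Ψ R i} {Ψ R (suc i)} (update R i 1≤i i<k) 0≤d
    (proj₁ (proj₁ (basic R i 1≤i (<⇒≤ i<k))))
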